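{- Let $(f,C)$ be a low-defect pair of degree $r$, let $x_i$ be a variable of $f$ that is minimal with respect to the nesting ordering, let $k\ge0$ be an integer, and define \[ g(x_1,\ldots,x_{i-1},x_{i+1},\ldots,x_r):=f(x_1,\ldots,x_{i-1},3^k,x_{i+1},\ldots,x_r). \] Then: (1) $g$ is a low-defect polynomial and $(g,C+3k)$ is a low-defect pair; (2) if $a$ is the leading coefficient of $f$, the leading coefficient of $g$ is strictly greater than $a3^k$, and hence $\delta(g,C+3k)<\delta(f,C)$; (3) the nesting order on the variables of $g$ is the restriction of the nesting order on the variables of $f$ to $\{x_1,\ldots,x_{i-1},x_{i+1},\ldots,x_r\}$; (4) for all nonnegative integers $k_1,\ldots,k_{i-1},k_{i+1},\ldots,k_r$, \[ \delta_{g,C+3k}(k_1,\ldots,k_{i-1},k_{i+1},\ldots,k_r)=\delta_{f,C}(k_1,\ldots,k_{i-1},k,k_{i+1},\ldots,k_r). \]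
   Context: $\|n\|$ is the least number of $1$'s needed to write $n\in\mathbb{N}$ using $1$, $+$, $\times$, parentheses. Low-defect expressions: (a) every positive integer constant is one; (b) the product of two low-defect expressions with disjoint variable sets is one; (c) if $E$ is one, $c$ a positive integer and $x$ a variable not in $E$, then $E\cdot x+c$ is one. The complexity $\|E\|$ of such an expression is the sum of the complexities of the integer constants occurring in it. A low-defect polynomial is the polynomial obtained by evaluating a low-defect expression, and $(f,C)$ is a low-defect pair if $f$ is obtained from some low-defect expression $E$ with $\|E\|\le C$. A low-defect polynomial of degree $r$ is multilinear in $r$ variables with nonnegative integer coefficients and nonzero leading coefficient (coefficient of the product of all its variables). Define $\delta(f,C)=C-3\log_3 a$ ($a$ the leading coefficient) and $\delta_{f,C}(n_1,\ldots,n_r)=C+3(n_1+\cdots+n_r)-3\log_3 f(3^{n_1},\ldots,3^{n_r})$. Nesting ordering: for variables $x,y$ of a low-defect expression $E$, $x\preceq y$ iff $x$ appears in the smallest low-defect subexpression of $E$ containing $y$. This partial order depends only on the polynomial evaluated by $E$ and is called the nesting ordering of that polynomial. -}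

module Defs where

open import Data.Nat using (ℕ; zero; suc; _+_; _*_; _^_; _≤_; _<_)
open import Data.Fin using (Fin; zero; suc; punchIn)
open import Data.Product using (Σ; ∃; _×_; _,_)
open import Data.Sum using (_⊎_)
open import Data.Empty using (⊥)
open import Relation.Nullary using (¬_)
open import Relation.Binary.PropositionalEquality using (_≡_)
open import Data.Vec.Functional using (insertAt)

-- Integer complexity ‖n‖: least number of 1's in an expression built
-- from 1, +, × (parentheses are implicit in the tree structure).

data AExpr : Set where
  one   : AExpr
  plus  : AExpr → AExpr → AExpr
  times : AExpr → AExpr → AExpr

aval : AExpr → ℕ
aval one         = 1
aval (plus a b)  = aval a + aval b
aval (times a b) = aval a * aval b

ones : AExpr → ℕ
ones one         = 1
ones (plus a b)  = ones a + ones b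
ones (times a b) = ones a + ones b

IsCpx : ℕ → ℕ → Set
IsCpx n m = (Σ AExpr λ e → aval e ≡ n × ones e ≡ m)
          × (∀ (e : AExpr) → aval e ≡ n → m ≤ ones e)

-- Multilinear polynomials in n variables x₀,…,x_{n-1} with ℕ coefficients,
-- in recursive normal form: an element (p₀ , p₁) of MPoly (suc n) stands
-- for p₀ + x₀ · p₁ (p₀, p₁ in the variables x₁,…).

MPoly : ℕ → Set
MPoly zero    = ℕ
MPoly (suc n) = MPoly n × MPoly n

pconst : ∀ {n} → ℕ → MPoly n
pconst {zero}  c = c
pconst {suc n} c = pconst c , pconst 0

_+p_ : ∀ {n} → MPoly n → MPoly n → MPoly n
_+p_ {zero}  a b = a + b
_+p_ {suc n} (p₀ , p₁) (q₀ , q₁) = (p₀ +p q₀) , (p₁ +p q₁)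

_·p_ : ∀ {n} → ℕ → MPoly n → MPoly n
_·p_ {zero}  c a = c * a
_·p_ {suc n} c (p₀ , p₁) = (c ·p p₀) , (c ·p p₁)

-- Product of multilinear polynomials, computed modulo x_j² (j = all variables).
-- On polynomials with disjoint variable sets (the only products that occur
-- in low-defect expressions) this is the ordinary polynomial product.
_*p_ : ∀ {n} → MPoly n → MPoly n → MPoly n
_*p_ {zero}  a b = a * b
_*p_ {suc n} (p₀ , p₁) (q₀ , q₁) = (p₀ *p q₀) , ((p₀ *p q₁) +p (p₁ *p q₀))

pvar : ∀ {n} → Fin n → MPoly n
pvar {suc n} zero    = pconst 0 , pconst 1
pvar {suc n} (suc j) = pvar j , pconst 0

-- leading coefficient: coefficient of x₀ x₁ ⋯ x_{n-1}
lead : ∀ {n} → MPoly n → ℕ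
lead {zero}  c         = c
lead {suc n} (p₀ , p₁) = lead p₁

eval : ∀ {n} → MPoly n → (Fin n → ℕ) → ℕ
eval {zero}  c         v = c
eval {suc n} (p₀ , p₁) v = eval p₀ (λ j → v (suc j)) + v zero * eval p₁ (λ j → v (suc j))

substAt : ∀ {n} → Fin (suc n) → ℕ → MPoly (suc n) → MPoly n
substAt zero c (p₀ , p₁) = p₀ +p (c ·p p₁)
substAt {suc n} (suc i) c (p₀ , p₁) = substAt i c p₀ , substAt i c p₁

data LDE (n : ℕ) : Set where
  cst : ℕ → LDE n
  _⊗_ : LDE n → LDE n → LDE n
  lin : LDE n → Fin n → ℕ → LDE n       -- lin E x c  =  E · x + c

Occ : ∀ {n} → Fin n → LDE n → Set
Occ x (cst c)     = ⊥
Occ x (E₁ ⊗ E₂)   = Occ x E₁ ⊎ Occ x E₂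
Occ x (lin E y c) = Occ x E ⊎ x ≡ y

WF : ∀ {n} → LDE n → Set
WF (cst c)     = 1 ≤ c
WF (E₁ ⊗ E₂)   = WF E₁ × WF E₂ × (∀ x → Occ x E₁ → ¬ Occ x E₂)
WF (lin E x c) = WF E × ¬ Occ x E × 1 ≤ c

poly : ∀ {n} → LDE n → MPoly n
poly (cst c)     = pconst c
poly (E₁ ⊗ E₂)   = poly E₁ *p poly E₂
poly (lin E x c) = (poly E *p pvar x) +p pconst c

Cpx : ∀ {n} → LDE n → ℕ → Set
Cpx (cst c)     m = IsCpx c m
Cpx (E₁ ⊗ E₂)   m = Σ ℕ λ m₁ → Σ ℕ λ m₂ → Cpx E₁ m₁ × Cpx E₂ m₂ × m ≡ m₁ + m₂
Cpx (lin E x c) m = Σ ℕ λ m₁ → Σ ℕ λ m₂ → Cpx E m₁ × IsCpx c m₂ × m ≡ m₁ + m₂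

Represents : ∀ {r} → LDE r → MPoly r → Set
Represents {r} E f = WF E × (∀ (x : Fin r) → Occ x E) × poly E ≡ f

IsLDPoly : ∀ {r} → MPoly r → Set
IsLDPoly {r} f = Σ (LDE r) λ E → Represents E f

LDPair : ∀ {r} → MPoly r → ℕ → Set
LDPair {r} f C = Σ (LDE r) λ E → Represents E f × (Σ ℕ λ m → Cpx E m × m ≤ C)

data _⊑_ {n : ℕ} : LDE n → LDE n → Set where
  ⊑-refl : ∀ {E} → E ⊑ E
  ⊑-⊗ˡ   : ∀ {S E₁ E₂} → S ⊑ E₁ → S ⊑ (E₁ ⊗ E₂)
  ⊑-⊗ʳ   : ∀ {S E₁ E₂} → S ⊑ E₂ → S ⊑ (E₁ ⊗ E₂)
  ⊑-lin  : ∀ {S E x c} → S ⊑ E → S ⊑ lin E x c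

NestE : ∀ {n} → LDE n → Fin n → Fin n → Set
NestE E x y = Σ _ λ S → S ⊑ E × Occ y S
            × (∀ S′ → S′ ⊑ E → Occ y S′ → S ⊑ S′)
            × Occ x S

Nest : ∀ {r} → MPoly r → Fin r → Fin r → Set
Nest {r} f x y = Σ (LDE r) λ E → Represents E f × NestE E x y

NestMinimal : ∀ {r} → MPoly r → Fin r → Set
NestMinimal f x = ∀ y → Nest f y x → y ≡ x

-- No reals are available: a quantity  C − 3 log₃ a  (a ≥ 1) is
-- represented by the pair (C , a); comparisons are decided exactly:
--   C₁ − 3log₃ a₁ < C₂ − 3log₃ a₂  ⇔  3^C₁ · a₂³ < 3^C₂ · a₁³.

record Defect : Set where
  constructor defect
  field
    base : ℕ
    arg  : ℕ

_<δ_ : Defect → Defect → Set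
defect C₁ a₁ <δ defect C₂ a₂ = 3 ^ C₁ * a₂ ^ 3 < 3 ^ C₂ * a₁ ^ 3

_≈δ_ : Defect → Defect → Set
defect C₁ a₁ ≈δ defect C₂ a₂ = 3 ^ C₁ * a₂ ^ 3 ≡ 3 ^ C₂ * a₁ ^ 3

δ : ∀ {r} → MPoly r → ℕ → Defect
δ f C = defect C (lead f)

sumF : ∀ {r} → (Fin r → ℕ) → ℕ
sumF {zero}  ks = 0
sumF {suc r} ks = ks zero + sumF (λ j → ks (suc j))

δat : ∀ {r} → MPoly r → ℕ → (Fin r → ℕ) → Defect
δat f C ns = defect (C + 3 * sumF ns) (eval f (λ j → 3 ^ ns j))

-- Minimality of xᵢ means that in a low-defect expression E for f the binder  lin S xᵢ c  of xᵢ
-- (the smallest subexpression containing xᵢ) has a closed body S.  Substituting 3ᵏ for xᵢ turns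
-- this binder into the constant S·3ᵏ + c, of complexity at most ‖S‖ + 3k + ‖c‖, and leaves a
-- low-defect expression for g.  Since f is multilinear, lead g = lead (f with xᵢ := 0) + 3ᵏ · lead f,
-- and the first summand is the (positive) leading coefficient of a low-defect polynomial.
-- For the nesting order we use a characterisation that does not mention E: x ⪯ y iff x = y or,
-- once y is set to 0, the value of f no longer depends on x.  This property passes through the
-- substitution because f is multilinear with coefficients in ℕ and 3ᵏ ≥ 1.

module Submission where

open import Data.Bool using (Bool; true; false; if_then_else_; _∧_; _∨_)
open import Data.Empty using (⊥-elim)
open import Data.Fin using (Fin; zero; suc; punchIn; punchOut)
import Data.Fin as Fin
open import Data.Fin.Properties using (punchIn-injective; punchInᵢ≢i; punchIn-punchOut)
open import Data.List using (List; []; [_]; _++_; cartesianProductWith)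
open import Data.List.Membership.Propositional using (_∈_; lose)
open import Data.List.Membership.Propositional.Properties using (∈-++⁺ˡ; ∈-++⁺ʳ; ∈-cartesianProductWith⁺)
open import Data.List.Relation.Unary.Any using (here; there; any?; satisfied)
open import Data.Nat using (ℕ; zero; suc; _+_; _*_; _^_; _<_; _≤_; >-nonZero)
open import Data.Nat.Properties
open import Algebra.Properties.CommutativeSemigroup +-commutativeSemigroup using (xy∙z≈xz∙y)
open import Data.Nat.Tactic.RingSolver using (solve-∀)
open import Data.Product using (Σ; _×_; _,_; proj₁; proj₂)
open import Data.Sum using (_⊎_; inj₁; inj₂)
import Data.Sum as Sum
open import Data.Vec.Functional using (Vector; _∷_; tail; insertAt; removeAt; updateAt)
open import Data.Vec.Functional.Properties
  using (updateAt-updates; updateAt-minimal; updateAt-commutes; updateAt-id-local; insertAt-lookup; insertAt-punchIn)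
open import Function using (_∘_; const)
open import Function.Bundles using (_⇔_; mk⇔)
open import Function.Construct.Composition using (_⇔-∘_)
open import Function.Construct.Symmetry using (⇔-sym)
open import Relation.Binary.PropositionalEquality
  using (_≡_; _≢_; _≗_; refl; sym; trans; cong; cong₂; subst; subst₂; module ≡-Reasoning)
open import Relation.Nullary using (¬_; Dec; yes; no; does)
open import Relation.Nullary.Decidable using (_⊎-dec_; _×-dec_; dec-true; dec-false)

open import Defs

infixl 6 _[_]≔_

_[_]≔_ : ∀ {n} {A : Set} → Vector A n → Fin n → A → Vector A n
v [ j ]≔ a = updateAt v j (const a)

[]≔-cong : ∀ {n} {A : Set} {u w : Vector A n} (j : Fin n) (a : A) → u ≗ w → u [ j ]≔ a ≗ w [ j ]≔ a
[]≔-cong zero    a u≗w zero    = refl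
[]≔-cong zero    a u≗w (suc k) = u≗w (suc k)
[]≔-cong (suc j) a u≗w zero    = u≗w zero
[]≔-cong (suc j) a u≗w (suc k) = []≔-cong j a (u≗w ∘ suc) k

insertAt-[]≔ : ∀ {n} {A : Set} (v : Vector A n) (i : Fin (suc n)) (c : A) (y : Fin n) (a : A) →
               insertAt (v [ y ]≔ a) i c ≗ insertAt v i c [ punchIn i y ]≔ a
insertAt-[]≔         v zero    c y       a zero    = refl
insertAt-[]≔         v zero    c y       a (suc k) = refl
insertAt-[]≔ {suc n} v (suc i) c zero    a zero    = refl
insertAt-[]≔ {suc n} v (suc i) c zero    a (suc k) = refl
insertAt-[]≔ {suc n} v (suc i) c (suc y) a zero    = refl
insertAt-[]≔ {suc n} v (suc i) c (suc y) a (suc k) = insertAt-[]≔ (tail v) i c y a k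

insertAt-removeAt-[]≔ : ∀ {n} {A : Set} (u : Vector A (suc n)) (i : Fin (suc n)) (c : A) →
                        insertAt (removeAt u i) i c ≗ u [ i ]≔ c
insertAt-removeAt-[]≔         u zero    c zero    = refl
insertAt-removeAt-[]≔         u zero    c (suc k) = refl
insertAt-removeAt-[]≔ {suc n} u (suc i) c zero    = refl
insertAt-removeAt-[]≔ {suc n} u (suc i) c (suc k) = insertAt-removeAt-[]≔ (tail u) i c k

insertAt-map : ∀ {n} {A B : Set} (f : A → B) (xs : Vector A n) (i : Fin (suc n)) (a : A) →
               f ∘ insertAt xs i a ≗ insertAt (f ∘ xs) i (f a)
insertAt-map         f xs zero    a zero    = refl
insertAt-map         f xs zero    a (suc j) = refl
insertAt-map {suc n} f xs (suc i) a zero    = refl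
insertAt-map {suc n} f xs (suc i) a (suc j) = insertAt-map f (tail xs) i a j

eval-cong : ∀ {n} (p : MPoly n) {u w : Vector ℕ n} → u ≗ w → eval p u ≡ eval p w
eval-cong {zero}  p         u≗w = refl
eval-cong {suc n} (p₀ , p₁) u≗w =
  cong₂ _+_ (eval-cong p₀ (u≗w ∘ suc)) (cong₂ _*_ (u≗w zero) (eval-cong p₁ (u≗w ∘ suc)))

eval-pconst : ∀ {n} (c : ℕ) (v : Vector ℕ n) → eval (pconst {n} c) v ≡ c
eval-pconst {zero}  c v = refl
eval-pconst {suc n} c v = begin
  eval (pconst {n} c) (tail v) + v zero * eval (pconst {n} 0) (tail v)
    ≡⟨ cong₂ (λ a b → a + v zero * b) (eval-pconst c (tail v)) (eval-pconst 0 (tail v)) ⟩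
  c + v zero * 0
    ≡⟨ cong (c +_) (*-zeroʳ (v zero)) ⟩
  c + 0
    ≡⟨ +-identityʳ c ⟩
  c ∎
  where open ≡-Reasoning

eval-+p : ∀ {n} (p q : MPoly n) (v : Vector ℕ n) → eval (p +p q) v ≡ eval p v + eval q v
eval-+p {zero}  p         q         v = refl
eval-+p {suc n} (p₀ , p₁) (q₀ , q₁) v = begin
  eval (p₀ +p q₀) (tail v) + v zero * eval (p₁ +p q₁) (tail v)
    ≡⟨ cong₂ (λ s t → s + v zero * t) (eval-+p p₀ q₀ (tail v)) (eval-+p p₁ q₁ (tail v)) ⟩
  (eval p₀ (tail v) + eval q₀ (tail v)) + v zero * (eval p₁ (tail v) + eval q₁ (tail v))
    ≡⟨ regroup (eval p₀ (tail v)) (eval q₀ (tail v)) (eval p₁ (tail v)) (eval q₁ (tail v)) (v zero) ⟩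
  (eval p₀ (tail v) + v zero * eval p₁ (tail v)) + (eval q₀ (tail v) + v zero * eval q₁ (tail v)) ∎
  where
  open ≡-Reasoning
  regroup : ∀ a b c d x → (a + b) + x * (c + d) ≡ (a + x * c) + (b + x * d)
  regroup = solve-∀

eval-·p : ∀ {n} (c : ℕ) (p : MPoly n) (v : Vector ℕ n) → eval (c ·p p) v ≡ c * eval p v
eval-·p {zero}  c p         v = refl
eval-·p {suc n} c (p₀ , p₁) v = begin
  eval (c ·p p₀) (tail v) + v zero * eval (c ·p p₁) (tail v)
    ≡⟨ cong₂ (λ s t → s + v zero * t) (eval-·p c p₀ (tail v)) (eval-·p c p₁ (tail v)) ⟩
  c * eval p₀ (tail v) + v zero * (c * eval p₁ (tail v))
    ≡⟨ factor c (eval p₀ (tail v)) (eval p₁ (tail v)) (v zero) ⟩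
  c * (eval p₀ (tail v) + v zero * eval p₁ (tail v)) ∎
  where
  open ≡-Reasoning
  factor : ∀ c a b x → c * a + x * (c * b) ≡ c * (a + x * b)
  factor = solve-∀

eval-pvar : ∀ {n} (x : Fin n) (v : Vector ℕ n) → eval (pvar x) v ≡ v x
eval-pvar {suc n} zero v = begin
  eval (pconst {n} 0) (tail v) + v zero * eval (pconst {n} 1) (tail v)
    ≡⟨ cong₂ (λ a b → a + v zero * b) (eval-pconst 0 (tail v)) (eval-pconst 1 (tail v)) ⟩
  v zero * 1
    ≡⟨ *-identityʳ (v zero) ⟩
  v zero ∎
  where open ≡-Reasoning
eval-pvar {suc n} (suc x) v = begin
  eval (pvar x) (tail v) + v zero * eval (pconst {n} 0) (tail v)
    ≡⟨ cong₂ (λ a b → a + v zero * b) (eval-pvar x (tail v)) (eval-pconst 0 (tail v)) ⟩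
  v (suc x) + v zero * 0
    ≡⟨ cong (v (suc x) +_) (*-zeroʳ (v zero)) ⟩
  v (suc x) + 0
    ≡⟨ +-identityʳ (v (suc x)) ⟩
  v (suc x) ∎
  where open ≡-Reasoning

eval-injective : ∀ {n} (p q : MPoly n) → (∀ v → eval p v ≡ eval q v) → p ≡ q
eval-injective {zero}  p         q         p≐q = p≐q (λ ())
eval-injective {suc n} (p₀ , p₁) (q₀ , q₁) p≐q = cong₂ _,_ p₀≡q₀ (eval-injective p₁ q₁ p₁≐q₁)
  where
  open ≡-Reasoning
  p₀≐q₀ : ∀ w → eval p₀ w ≡ eval q₀ w
  p₀≐q₀ w = begin
    eval p₀ w                 ≡⟨ +-identityʳ (eval p₀ w) ⟨
    eval (p₀ , p₁) (0 ∷ w)   ≡⟨ p≐q (0 ∷ w) ⟩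
    eval (q₀ , q₁) (0 ∷ w)   ≡⟨ +-identityʳ (eval q₀ w) ⟩
    eval q₀ w                 ∎
  p₀≡q₀ : p₀ ≡ q₀
  p₀≡q₀ = eval-injective p₀ q₀ p₀≐q₀
  p₁≐q₁ : ∀ w → eval p₁ w ≡ eval q₁ w
  p₁≐q₁ w = +-cancelˡ-≡ (eval p₀ w) (eval p₁ w) (eval q₁ w) (begin
    eval p₀ w + eval p₁ w       ≡⟨ cong (eval p₀ w +_) (*-identityˡ (eval p₁ w)) ⟨
    eval (p₀ , p₁) (1 ∷ w)     ≡⟨ p≐q (1 ∷ w) ⟩
    eval (q₀ , q₁) (1 ∷ w)     ≡⟨ cong₂ _+_ (sym (p₀≐q₀ w)) (*-identityˡ (eval q₁ w)) ⟩
    eval p₀ w + eval q₁ w       ∎)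

Independent : ∀ {n} → Fin n → MPoly n → Set
Independent j p = ∀ v a → eval p (v [ j ]≔ a) ≡ eval p v

independent-tail : ∀ {n} {j : Fin n} {p₀ p₁ : MPoly n} →
                   Independent (suc j) (p₀ , p₁) → Independent j p₀ × Independent j p₁
independent-tail {j = j} {p₀} {p₁} ind = ind₀ , ind₁
  where
  open ≡-Reasoning
  ind₀ : Independent j p₀
  ind₀ w a = begin
    eval p₀ (w [ j ]≔ a)                     ≡⟨ +-identityʳ _ ⟨
    eval (p₀ , p₁) ((0 ∷ w) [ suc j ]≔ a)   ≡⟨ ind (0 ∷ w) a ⟩
    eval (p₀ , p₁) (0 ∷ w)                  ≡⟨ +-identityʳ _ ⟩
    eval p₀ w                                ∎
  ind₁ : Independent j p₁
  ind₁ w a = +-cancelˡ-≡ (eval p₀ w) _ _ (begin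
    eval p₀ w + eval p₁ (w [ j ]≔ a)                   ≡⟨ cong₂ _+_ (ind₀ w a) (*-identityˡ _) ⟨
    eval (p₀ , p₁) ((1 ∷ w) [ suc j ]≔ a)              ≡⟨ ind (1 ∷ w) a ⟩
    eval (p₀ , p₁) (1 ∷ w)                             ≡⟨ cong (eval p₀ w +_) (*-identityˡ _) ⟩
    eval p₀ w + eval p₁ w                               ∎)

independent-head : ∀ {n} {p₀ p₁ : MPoly n} → Independent zero (p₀ , p₁) → ∀ w → eval p₁ w ≡ 0
independent-head {p₀ = p₀} {p₁} ind w = +-cancelˡ-≡ (eval p₀ w) _ _ (begin
  eval p₀ w + eval p₁ w                   ≡⟨ cong (eval p₀ w +_) (*-identityˡ _) ⟨
  eval (p₀ , p₁) ((0 ∷ w) [ zero ]≔ 1)   ≡⟨ ind (0 ∷ w) 1 ⟩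
  eval (p₀ , p₁) (0 ∷ w)                 ≡⟨⟩
  eval p₀ w + 0                           ∎)
  where open ≡-Reasoning

DisjointVars : ∀ {n} → MPoly n → MPoly n → Set
DisjointVars {n} p q = ∀ (j : Fin n) → Independent j p ⊎ Independent j q

disjointVars-tail : ∀ {n} {p₀ p₁ q₀ q₁ p q : MPoly n} → DisjointVars (p₀ , p₁) (q₀ , q₁) →
                    (∀ {j} → Independent j p₀ × Independent j p₁ → Independent j p) →
                    (∀ {j} → Independent j q₀ × Independent j q₁ → Independent j q) →
                    DisjointVars p q
disjointVars-tail disj select-p select-q j =
  Sum.map (select-p ∘ independent-tail) (select-q ∘ independent-tail) (disj (suc j))

-- The x² term vanishes because one of the two factors does not involve x.
multilinear-product : ∀ a b c d x → b * d ≡ 0 → (a + x * b) * (c + x * d) ≡ a * c + x * (a * d + b * c)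
multilinear-product a b c d x bd≡0 = begin
  (a + x * b) * (c + x * d)                            ≡⟨ expand a b c d x ⟩
  a * c + x * (a * d + b * c) + x * x * (b * d)        ≡⟨ cong (λ t → a * c + x * (a * d + b * c) + x * x * t) bd≡0 ⟩
  a * c + x * (a * d + b * c) + x * x * 0              ≡⟨ cong (a * c + x * (a * d + b * c) +_) (*-zeroʳ (x * x)) ⟩
  a * c + x * (a * d + b * c) + 0                      ≡⟨ +-identityʳ _ ⟩
  a * c + x * (a * d + b * c)                          ∎
  where
  open ≡-Reasoning
  expand : ∀ a b c d x → (a + x * b) * (c + x * d) ≡ a * c + x * (a * d + b * c) + x * x * (b * d)
  expand = solve-∀

eval-*p : ∀ {n} (p q : MPoly n) → DisjointVars p q → ∀ v → eval (p *p q) v ≡ eval p v * eval q v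
eval-*p {zero}  p         q         disj v = refl
eval-*p {suc n} (p₀ , p₁) (q₀ , q₁) disj v = begin
  eval (p₀ *p q₀) (tail v) + v zero * eval ((p₀ *p q₁) +p (p₁ *p q₀)) (tail v)
    ≡⟨ cong₂ (λ s t → s + v zero * t)
             (eval-*p p₀ q₀ (disjointVars-tail disj proj₁ proj₁) (tail v))
             (trans (eval-+p (p₀ *p q₁) (p₁ *p q₀) (tail v))
                    (cong₂ _+_ (eval-*p p₀ q₁ (disjointVars-tail disj proj₁ proj₂) (tail v))
                               (eval-*p p₁ q₀ (disjointVars-tail disj proj₂ proj₁) (tail v)))) ⟩
  a * c + v zero * (a * d + b * c)
    ≡⟨ multilinear-product a b c d (v zero) bd≡0 ⟨
  (a + v zero * b) * (c + v zero * d) ∎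
  where
  open ≡-Reasoning
  a = eval p₀ (tail v)
  b = eval p₁ (tail v)
  c = eval q₀ (tail v)
  d = eval q₁ (tail v)
  bd≡0 : b * d ≡ 0
  bd≡0 with disj zero
  ... | inj₁ ind = cong (_* d) (independent-head ind (tail v))
  ... | inj₂ ind = trans (cong (b *_) (independent-head ind (tail v))) (*-zeroʳ b)

⟦_⟧ : ∀ {n} → LDE n → Vector ℕ n → ℕ
⟦ cst c     ⟧ v = c
⟦ E₁ ⊗ E₂   ⟧ v = ⟦ E₁ ⟧ v * ⟦ E₂ ⟧ v
⟦ lin E x c ⟧ v = ⟦ E ⟧ v * v x + c

occurs? : ∀ {n} (x : Fin n) (E : LDE n) → Dec (Occ x E)
occurs? x (cst c)     = no λ ()
occurs? x (E₁ ⊗ E₂)   = occurs? x E₁ ⊎-dec occurs? x E₂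
occurs? x (lin E y c) = occurs? x E ⊎-dec x Fin.≟ y

⟦⟧-independent : ∀ {n} (E : LDE n) {x} → ¬ Occ x E → ∀ v a → ⟦ E ⟧ (v [ x ]≔ a) ≡ ⟦ E ⟧ v
⟦⟧-independent (cst c)       x∉E v a = refl
⟦⟧-independent (E₁ ⊗ E₂)     x∉E v a =
  cong₂ _*_ (⟦⟧-independent E₁ (x∉E ∘ inj₁) v a) (⟦⟧-independent E₂ (x∉E ∘ inj₂) v a)
⟦⟧-independent (lin E y c) {x} x∉E v a =
  cong (_+ c) (cong₂ _*_ (⟦⟧-independent E (x∉E ∘ inj₁) v a) (updateAt-minimal y x v (x∉E ∘ inj₂ ∘ sym)))

mutual
  eval-poly : ∀ {n} (E : LDE n) → WF E → ∀ v → eval (poly E) v ≡ ⟦ E ⟧ v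
  eval-poly (cst c)     wf v = eval-pconst c v
  eval-poly (E₁ ⊗ E₂)   (wf₁ , wf₂ , disj) v = begin
    eval (poly E₁ *p poly E₂) v             ≡⟨ eval-*p (poly E₁) (poly E₂) disjoint v ⟩
    eval (poly E₁) v * eval (poly E₂) v     ≡⟨ cong₂ _*_ (eval-poly E₁ wf₁ v) (eval-poly E₂ wf₂ v) ⟩
    ⟦ E₁ ⟧ v * ⟦ E₂ ⟧ v                     ∎
    where
    open ≡-Reasoning
    disjoint : DisjointVars (poly E₁) (poly E₂)
    disjoint j with occurs? j E₁
    ... | yes j∈E₁ = inj₂ (poly-independent E₂ wf₂ (disj j j∈E₁))
    ... | no  j∉E₁ = inj₁ (poly-independent E₁ wf₁ j∉E₁)
  eval-poly (lin E x c) (wf , x∉E , _) v = begin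
    eval ((poly E *p pvar x) +p pconst c) v         ≡⟨ eval-+p (poly E *p pvar x) (pconst c) v ⟩
    eval (poly E *p pvar x) v + eval (pconst c) v   ≡⟨ cong₂ _+_ (eval-*p (poly E) (pvar x) disjoint v) (eval-pconst c v) ⟩
    eval (poly E) v * eval (pvar x) v + c           ≡⟨ cong (_+ c) (cong₂ _*_ (eval-poly E wf v) (eval-pvar x v)) ⟩
    ⟦ E ⟧ v * v x + c                                ∎
    where
    open ≡-Reasoning
    disjoint : DisjointVars (poly E) (pvar x)
    disjoint j with j Fin.≟ x
    ... | yes refl = inj₁ (poly-independent E wf x∉E)
    ... | no  j≢x  = inj₂ λ u a → begin
      eval (pvar x) (u [ j ]≔ a)   ≡⟨ eval-pvar x _ ⟩
      (u [ j ]≔ a) x               ≡⟨ updateAt-minimal x j u (j≢x ∘ sym) ⟩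
      u x                          ≡⟨ eval-pvar x u ⟨
      eval (pvar x) u              ∎

  poly-independent : ∀ {n} (E : LDE n) → WF E → ∀ {j} → ¬ Occ j E → Independent j (poly E)
  poly-independent E wf {j} j∉E v a = begin
    eval (poly E) (v [ j ]≔ a)   ≡⟨ eval-poly E wf _ ⟩
    ⟦ E ⟧ (v [ j ]≔ a)           ≡⟨ ⟦⟧-independent E j∉E v a ⟩
    ⟦ E ⟧ v                      ≡⟨ eval-poly E wf v ⟨
    eval (poly E) v              ∎
    where open ≡-Reasoning

eval-represents : ∀ {n} {E : LDE n} {p} → Represents E p → ∀ v → eval p v ≡ ⟦ E ⟧ v
eval-represents {E = E} (wf , _ , refl) = eval-poly E wf

eval-substAt : ∀ {n} (i : Fin (suc n)) (c : ℕ) (p : MPoly (suc n)) (v : Vector ℕ n) →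
               eval (substAt i c p) v ≡ eval p (insertAt v i c)
eval-substAt zero c (p₀ , p₁) v =
  trans (eval-+p p₀ (c ·p p₁) v) (cong (eval p₀ v +_) (eval-·p c p₁ v))
eval-substAt {suc n} (suc i) c (p₀ , p₁) v =
  cong₂ (λ s t → s + v zero * t) (eval-substAt i c p₀ (tail v)) (eval-substAt i c p₁ (tail v))

-- Binders and the nesting order

Occ-⊑ : ∀ {n} {S E : LDE n} {x} → S ⊑ E → Occ x S → Occ x E
Occ-⊑ ⊑-refl    x∈S = x∈S
Occ-⊑ (⊑-⊗ˡ p)  x∈S = inj₁ (Occ-⊑ p x∈S)
Occ-⊑ (⊑-⊗ʳ p)  x∈S = inj₂ (Occ-⊑ p x∈S)
Occ-⊑ (⊑-lin p) x∈S = inj₁ (Occ-⊑ p x∈S)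

WF-⊑ : ∀ {n} {S E : LDE n} → S ⊑ E → WF E → WF S
WF-⊑ ⊑-refl    wf                = wf
WF-⊑ (⊑-⊗ˡ p)  (wf₁ , _ , _)     = WF-⊑ p wf₁
WF-⊑ (⊑-⊗ʳ p)  (_ , wf₂ , _)     = WF-⊑ p wf₂
WF-⊑ (⊑-lin p) (wf , _ , _)      = WF-⊑ p wf

binder : ∀ {n} (E : LDE n) {y} → Occ y E → Σ (LDE n) λ S → Σ ℕ λ c → lin S y c ⊑ E
binder (E₁ ⊗ E₂)   (inj₁ y∈E₁) with binder E₁ y∈E₁
... | S , c , p = S , c , ⊑-⊗ˡ p
binder (E₁ ⊗ E₂)   (inj₂ y∈E₂) with binder E₂ y∈E₂
... | S , c , p = S , c , ⊑-⊗ʳ p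
binder (lin E z d) (inj₁ y∈E) with binder E y∈E
... | S , c , p = S , c , ⊑-lin p
binder (lin E z d) (inj₂ refl) = E , d , ⊑-refl

binder-least : ∀ {n} {E : LDE n} → WF E → ∀ {S y c S′} → lin S y c ⊑ E → S′ ⊑ E → Occ y S′ → lin S y c ⊑ S′
binder-least {E = cst _} wf () q y∈S′
binder-least {E = E₁ ⊗ E₂}   wf                p         ⊑-refl    y∈S′ = p
binder-least {E = E₁ ⊗ E₂}   (wf₁ , _ , _)     (⊑-⊗ˡ p)  (⊑-⊗ˡ q)  y∈S′ = binder-least wf₁ p q y∈S′
binder-least {E = E₁ ⊗ E₂}   (_ , wf₂ , _)     (⊑-⊗ʳ p)  (⊑-⊗ʳ q)  y∈S′ = binder-least wf₂ p q y∈S′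
binder-least {E = E₁ ⊗ E₂}   (_ , _ , disj)    (⊑-⊗ˡ p)  (⊑-⊗ʳ q)  y∈S′ =
  ⊥-elim (disj _ (Occ-⊑ p (inj₂ refl)) (Occ-⊑ q y∈S′))
binder-least {E = E₁ ⊗ E₂}   (_ , _ , disj)    (⊑-⊗ʳ p)  (⊑-⊗ˡ q)  y∈S′ =
  ⊥-elim (disj _ (Occ-⊑ q y∈S′) (Occ-⊑ p (inj₂ refl)))
binder-least {E = lin E z d} wf                p         ⊑-refl    y∈S′ = p
binder-least {E = lin E z d} (_ , z∉E , _)     ⊑-refl    (⊑-lin q) y∈S′ = ⊥-elim (z∉E (Occ-⊑ q y∈S′))
binder-least {E = lin E z d} (wf , _ , _)      (⊑-lin p) (⊑-lin q) y∈S′ = binder-least wf p q y∈S′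

⟦⟧-pos : ∀ {n} (E : LDE n) → WF E → ∀ v → 1 ≤ ⟦ E ⟧ v
⟦⟧-pos (cst c)     1≤c                v = 1≤c
⟦⟧-pos (E₁ ⊗ E₂)   (wf₁ , wf₂ , _)    v = *-mono-≤ (⟦⟧-pos E₁ wf₁ v) (⟦⟧-pos E₂ wf₂ v)
⟦⟧-pos (lin E x c) (_ , _ , 1≤c)      v = ≤-trans 1≤c (m≤n+m c _)

*-monoˡ-<-pos : ∀ {a b} c → 1 ≤ c → a < b → a * c < b * c
*-monoˡ-<-pos c 1≤c = *-monoˡ-< c {{>-nonZero 1≤c}}

*-monoʳ-<-pos : ∀ {a b} c → 1 ≤ c → a < b → c * a < c * b
*-monoʳ-<-pos c 1≤c = *-monoʳ-< c {{>-nonZero 1≤c}}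

⟦⟧-binder-vanishes : ∀ {n} {E : LDE n} {S y c x} → WF E → lin S y c ⊑ E → Occ x S →
                     ∀ v a → ⟦ E ⟧ (v [ y ]≔ 0 [ x ]≔ a) ≡ ⟦ E ⟧ (v [ y ]≔ 0)
⟦⟧-binder-vanishes {E = lin S y c} {x = x} (_ , y∉S , _) ⊑-refl x∈S v a = begin
  ⟦ S ⟧ (v′ [ x ]≔ a) * (v′ [ x ]≔ a) y + c   ≡⟨ cong (λ t → ⟦ S ⟧ (v′ [ x ]≔ a) * t + c) y↦0 ⟩
  ⟦ S ⟧ (v′ [ x ]≔ a) * 0 + c                 ≡⟨ cong (_+ c) (*-zeroʳ (⟦ S ⟧ (v′ [ x ]≔ a))) ⟩
  c                                            ≡⟨ cong (_+ c) (*-zeroʳ (⟦ S ⟧ v′)) ⟨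
  ⟦ S ⟧ v′ * 0 + c                            ≡⟨ cong (λ t → ⟦ S ⟧ v′ * t + c) (updateAt-updates y v) ⟨
  ⟦ S ⟧ v′ * v′ y + c                         ∎
  where
  open ≡-Reasoning
  v′ = v [ y ]≔ 0
  y↦0 : (v′ [ x ]≔ a) y ≡ 0
  y↦0 = trans (updateAt-minimal y x v′ λ { refl → y∉S x∈S }) (updateAt-updates y v)
⟦⟧-binder-vanishes {E = E₁ ⊗ E₂} (wf₁ , _ , disj) (⊑-⊗ˡ p) x∈S v a =
  cong₂ _*_ (⟦⟧-binder-vanishes wf₁ p x∈S v a) (⟦⟧-independent E₂ (disj _ (Occ-⊑ p (inj₁ x∈S))) _ a)
⟦⟧-binder-vanishes {E = E₁ ⊗ E₂} (_ , wf₂ , disj) (⊑-⊗ʳ p) x∈S v a =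
  cong₂ _*_ (⟦⟧-independent E₁ (λ x∈E₁ → disj _ x∈E₁ (Occ-⊑ p (inj₁ x∈S))) _ a) (⟦⟧-binder-vanishes wf₂ p x∈S v a)
⟦⟧-binder-vanishes {E = lin E z d} {x = x} (wf , z∉E , _) (⊑-lin p) x∈S v a =
  cong (_+ d) (cong₂ _*_ (⟦⟧-binder-vanishes wf p x∈S v a)
                         (updateAt-minimal z x _ λ { refl → z∉E (Occ-⊑ p (inj₁ x∈S)) }))

-- Only the multipliers z of the binders enclosing x need to be positive: every other factor is a positive subexpression.
⟦⟧-strictMono : ∀ {n} (E : LDE n) → WF E → ∀ {x} → Occ x E → ∀ w →
                (∀ {S z c} → lin S z c ⊑ E → Occ x S → 1 ≤ w z) →
                ⟦ E ⟧ (w [ x ]≔ 0) < ⟦ E ⟧ (w [ x ]≔ 1)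
⟦⟧-strictMono (E₁ ⊗ E₂) (wf₁ , wf₂ , disj) {x} (inj₁ x∈E₁) w enclosing-pos =
  subst₂ (λ s t → ⟦ E₁ ⟧ (w [ x ]≔ 0) * s < ⟦ E₁ ⟧ (w [ x ]≔ 1) * t)
    (sym (⟦⟧-independent E₂ (disj x x∈E₁) w 0)) (sym (⟦⟧-independent E₂ (disj x x∈E₁) w 1))
    (*-monoˡ-<-pos (⟦ E₂ ⟧ w) (⟦⟧-pos E₂ wf₂ w)
      (⟦⟧-strictMono E₁ wf₁ x∈E₁ w λ p → enclosing-pos (⊑-⊗ˡ p)))
⟦⟧-strictMono (E₁ ⊗ E₂) (wf₁ , wf₂ , disj) {x} (inj₂ x∈E₂) w enclosing-pos =
  subst₂ (λ s t → s * ⟦ E₂ ⟧ (w [ x ]≔ 0) < t * ⟦ E₂ ⟧ (w [ x ]≔ 1))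
    (sym (⟦⟧-independent E₁ x∉E₁ w 0)) (sym (⟦⟧-independent E₁ x∉E₁ w 1))
    (*-monoʳ-<-pos (⟦ E₁ ⟧ w) (⟦⟧-pos E₁ wf₁ w)
      (⟦⟧-strictMono E₂ wf₂ x∈E₂ w λ p → enclosing-pos (⊑-⊗ʳ p)))
  where
  x∉E₁ : ¬ Occ x E₁
  x∉E₁ x∈E₁ = disj x x∈E₁ x∈E₂
⟦⟧-strictMono (lin E z d) (wf , z∉E , _) {x} (inj₁ x∈E) w enclosing-pos =
  subst₂ (λ s t → ⟦ E ⟧ (w [ x ]≔ 0) * s + d < ⟦ E ⟧ (w [ x ]≔ 1) * t + d)
    (sym (updateAt-minimal z x w z≢x)) (sym (updateAt-minimal z x w z≢x))
    (+-monoˡ-< d (*-monoˡ-<-pos (w z) (enclosing-pos ⊑-refl x∈E)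
      (⟦⟧-strictMono E wf x∈E w λ p → enclosing-pos (⊑-lin p))))
  where
  z≢x : z ≢ x
  z≢x refl = z∉E x∈E
⟦⟧-strictMono (lin E x d) (wf , x∉E , _) (inj₂ refl) w enclosing-pos =
  subst₂ _<_ (sym (value 0)) (sym (value 1))
    (+-monoˡ-< d (subst₂ _<_ (sym (*-zeroʳ (⟦ E ⟧ w))) (sym (*-identityʳ (⟦ E ⟧ w))) (⟦⟧-pos E wf w)))
  where
  value : ∀ a → ⟦ E ⟧ (w [ x ]≔ a) * (w [ x ]≔ a) x + d ≡ ⟦ E ⟧ w * a + d
  value a = cong (_+ d) (cong₂ _*_ (⟦⟧-independent E x∉E w a) (updateAt-updates x w))

-- Setting y to 0 turns the binder lin S y c of y into the constant c, so exactly the variables of S stop mattering.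
Nestˢ : ∀ {n} → MPoly n → Fin n → Fin n → Set
Nestˢ p x y = x ≡ y ⊎ (∀ v → eval p (v [ y ]≔ 0 [ x ]≔ 0) ≡ eval p (v [ y ]≔ 0 [ x ]≔ 1))

Nest⇒Nestˢ : ∀ {n} {p : MPoly n} {x y} → Nest p x y → Nestˢ p x y
Nest⇒Nestˢ {p = p} {x} {y} (E , rep@(wf , all , _) , S , S⊑E , y∈S , S-least , x∈S)
  with binder E (all y)
... | S₀ , c , binder⊑E with Occ-⊑ (S-least _ binder⊑E (inj₂ refl)) x∈S
...   | inj₂ x≡y  = inj₁ x≡y
...   | inj₁ x∈S₀ = inj₂ λ v → begin
  eval p (v [ y ]≔ 0 [ x ]≔ 0)   ≡⟨ eval-represents rep _ ⟩
  ⟦ E ⟧ (v [ y ]≔ 0 [ x ]≔ 0)    ≡⟨ ⟦⟧-binder-vanishes wf binder⊑E x∈S₀ v 0 ⟩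
  ⟦ E ⟧ (v [ y ]≔ 0)             ≡⟨ ⟦⟧-binder-vanishes wf binder⊑E x∈S₀ v 1 ⟨
  ⟦ E ⟧ (v [ y ]≔ 0 [ x ]≔ 1)    ≡⟨ eval-represents rep _ ⟨
  eval p (v [ y ]≔ 0 [ x ]≔ 1)   ∎
  where open ≡-Reasoning

Nestˢ⇒Nest : ∀ {n} {p : MPoly n} {E} → Represents E p → ∀ {x y} → Nestˢ p x y → Nest p x y
Nestˢ⇒Nest {E = E} rep@(wf , all , _) {x} {y} nestˢ with binder E (all y)
... | S₀ , c , binder⊑E =
  E , rep , lin S₀ y c , binder⊑E , inj₂ refl , (λ S′ S′⊑E y∈S′ → binder-least wf binder⊑E S′⊑E y∈S′) , x∈binder nestˢ
  where
  w : Vector ℕ _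
  w = const 1 [ y ]≔ 0
  -- The binder of y does not enclose x, so all multipliers enclosing x equal 1 under w.
  enclosing-pos : ¬ Occ x S₀ → ∀ {S z d} → lin S z d ⊑ E → Occ x S → 1 ≤ w z
  enclosing-pos x∉S₀ {S} {z} q x∈S with z Fin.≟ y
  ... | no z≢y = ≤-reflexive (sym (updateAt-minimal z y (const 1) z≢y))
  enclosing-pos x∉S₀ {S} {z} q x∈S | yes refl
    with binder-least wf binder⊑E q (inj₂ refl)
  ... | ⊑-refl  = ⊥-elim (x∉S₀ x∈S)
  ... | ⊑-lin r = ⊥-elim (proj₁ (proj₂ (WF-⊑ q wf)) (Occ-⊑ r (inj₂ refl)))
  x∈binder : Nestˢ _ x y → Occ x (lin S₀ y c)
  x∈binder (inj₁ x≡y) = inj₂ x≡y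
  x∈binder (inj₂ x-ignored) with x Fin.≟ y | occurs? x S₀
  ... | yes x≡y | _         = inj₂ x≡y
  ... | no _    | yes x∈S₀  = inj₁ x∈S₀
  ... | no _    | no  x∉S₀  = ⊥-elim (<-irrefl
    (trans (sym (eval-represents rep _)) (trans (x-ignored (const 1)) (eval-represents rep _)))
    (⟦⟧-strictMono E wf (all x) w (enclosing-pos x∉S₀)))

Nest⇔Nestˢ : ∀ {n} {p : MPoly n} {E} → Represents E p → ∀ {x y} → Nest p x y ⇔ Nestˢ p x y
Nest⇔Nestˢ rep = mk⇔ Nest⇒Nestˢ (Nestˢ⇒Nest rep)

∂ : ∀ {n} → Fin n → MPoly n → MPoly n
∂ zero    (p₀ , p₁) = p₁ , pconst 0
∂ (suc j) (p₀ , p₁) = ∂ j p₀ , ∂ j p₁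

eval-[]≔-affine : ∀ {n} (p : MPoly n) (j : Fin n) (v : Vector ℕ n) (a : ℕ) →
                  eval p (v [ j ]≔ a) ≡ eval p (v [ j ]≔ 0) + a * eval (∂ j p) v
eval-[]≔-affine {suc n} (p₀ , p₁) zero v a = begin
  eval p₀ (tail v) + a * eval p₁ (tail v)
    ≡⟨ regroup (eval p₀ (tail v)) (eval p₁ (tail v)) a (v zero) ⟩
  (eval p₀ (tail v) + 0 * eval p₁ (tail v)) + a * (eval p₁ (tail v) + v zero * 0)
    ≡⟨ cong (λ t → (eval p₀ (tail v) + 0 * eval p₁ (tail v)) + a * (eval p₁ (tail v) + v zero * t))
            (eval-pconst 0 (tail v)) ⟨
  eval (p₀ , p₁) (v [ zero ]≔ 0) + a * eval (∂ zero (p₀ , p₁)) v ∎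
  where
  open ≡-Reasoning
  regroup : ∀ s t a x → s + a * t ≡ (s + 0 * t) + a * (t + x * 0)
  regroup = solve-∀
eval-[]≔-affine {suc n} (p₀ , p₁) (suc j) v a = begin
  eval p₀ (tail v [ j ]≔ a) + v zero * eval p₁ (tail v [ j ]≔ a)
    ≡⟨ cong₂ (λ s t → s + v zero * t) (eval-[]≔-affine p₀ j (tail v) a) (eval-[]≔-affine p₁ j (tail v) a) ⟩
  (P₀ + a * ∂P₀) + v zero * (P₁ + a * ∂P₁)
    ≡⟨ regroup P₀ P₁ ∂P₀ ∂P₁ a (v zero) ⟩
  (P₀ + v zero * P₁) + a * (∂P₀ + v zero * ∂P₁) ∎
  where
  open ≡-Reasoning
  P₀ = eval p₀ (tail v [ j ]≔ 0)
  P₁ = eval p₁ (tail v [ j ]≔ 0)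
  ∂P₀ = eval (∂ j p₀) (tail v)
  ∂P₁ = eval (∂ j p₁) (tail v)
  regroup : ∀ p q r s a x → (p + a * r) + x * (q + a * s) ≡ (p + x * q) + a * (r + x * s)
  regroup = solve-∀

-- With coefficients in ℕ, p(w[j ≔ c]) = p(w[j ≔ 0]) + c · ∂ⱼp(w) is a sum of two vanishing terms.
eval-vanishes-[]≔ : ∀ {n} (p : MPoly n) (j : Fin n) (w : Vector ℕ n) {c} → 1 ≤ c →
                    eval p (w [ j ]≔ c) ≡ 0 → eval p w ≡ 0
eval-vanishes-[]≔ p j w {c} 1≤c p[c]≡0 = begin
  eval p w                                       ≡⟨ eval-cong p (updateAt-id-local j w refl) ⟨
  eval p (w [ j ]≔ w j)                          ≡⟨ eval-[]≔-affine p j w (w j) ⟩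
  eval p (w [ j ]≔ 0) + w j * eval (∂ j p) w     ≡⟨ cong₂ (λ s t → s + w j * t) p[0]≡0 ∂p≡0 ⟩
  w j * 0                                        ≡⟨ *-zeroʳ (w j) ⟩
  0                                              ∎
  where
  open ≡-Reasoning
  sum≡0 : eval p (w [ j ]≔ 0) + c * eval (∂ j p) w ≡ 0
  sum≡0 = trans (sym (eval-[]≔-affine p j w c)) p[c]≡0
  p[0]≡0 : eval p (w [ j ]≔ 0) ≡ 0
  p[0]≡0 = m+n≡0⇒m≡0 _ sum≡0
  ∂p≡0 : eval (∂ j p) w ≡ 0
  ∂p≡0 with m*n≡0⇒m≡0∨n≡0 c (m+n≡0⇒n≡0 _ sum≡0)
  ... | inj₁ refl = ⊥-elim (<-irrefl refl 1≤c)
  ... | inj₂ ∂p≡0 = ∂p≡0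

eval-substAt-[]≔ : ∀ {r} (f : MPoly (suc r)) (i : Fin (suc r)) (c : ℕ) (v : Vector ℕ r) (y x : Fin r) (b a : ℕ) →
                   eval (substAt i c f) (v [ y ]≔ b [ x ]≔ a)
                     ≡ eval f (insertAt v i c [ punchIn i y ]≔ b [ punchIn i x ]≔ a)
eval-substAt-[]≔ f i c v y x b a = trans (eval-substAt i c f _) (eval-cong f λ k →
  trans (insertAt-[]≔ (v [ y ]≔ b) i c x a k)
        ([]≔-cong (punchIn i x) a (insertAt-[]≔ v i c y b) k))

Nestˢ-substAt : ∀ {r} (f : MPoly (suc r)) (i : Fin (suc r)) {c} → 1 ≤ c → (x y : Fin r) →
                Nestˢ (substAt i c f) x y ⇔ Nestˢ f (punchIn i x) (punchIn i y)
Nestˢ-substAt f i {c} 1≤c x y = mk⇔ to from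
  where
  open ≡-Reasoning
  x′ = punchIn i x
  y′ = punchIn i y
  to : Nestˢ (substAt i c f) x y → Nestˢ f x′ y′
  to (inj₁ x≡y)       = inj₁ (cong (punchIn i) x≡y)
  to (inj₂ x-ignored) = inj₂ λ u → sym (begin
    eval f (u [ y′ ]≔ 0 [ x′ ]≔ 1)                   ≡⟨ eval-[]≔-affine f x′ (u [ y′ ]≔ 0) 1 ⟩
    eval f (u [ y′ ]≔ 0 [ x′ ]≔ 0) + 1 * eval (∂ x′ f) (u [ y′ ]≔ 0)
      ≡⟨ cong (λ t → eval f (u [ y′ ]≔ 0 [ x′ ]≔ 0) + 1 * t) (∂f≡0 u) ⟩
    eval f (u [ y′ ]≔ 0 [ x′ ]≔ 0) + 0               ≡⟨ +-identityʳ _ ⟩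
    eval f (u [ y′ ]≔ 0 [ x′ ]≔ 0)                   ∎)
    where
    at-c : ∀ u a → eval f (u [ y′ ]≔ 0 [ i ]≔ c [ x′ ]≔ a)
                   ≡ eval (substAt i c f) ((removeAt u i) [ y ]≔ 0 [ x ]≔ a)
    at-c u a = sym (trans (eval-substAt-[]≔ f i c (removeAt u i) y x 0 a) (eval-cong f λ k →
      []≔-cong x′ a (λ t → trans ([]≔-cong y′ 0 (insertAt-removeAt-[]≔ u i c) t)
                                 (updateAt-commutes y′ i (punchInᵢ≢i i y) u t)) k))
    ∂f≡0 : ∀ u → eval (∂ x′ f) (u [ y′ ]≔ 0) ≡ 0
    ∂f≡0 u = eval-vanishes-[]≔ (∂ x′ f) i (u [ y′ ]≔ 0) 1≤c (begin
      eval (∂ x′ f) w        ≡⟨ *-identityˡ _ ⟨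
      1 * eval (∂ x′ f) w    ≡⟨ +-cancelˡ-≡ (eval f (w [ x′ ]≔ 0)) _ 0 (begin
        eval f (w [ x′ ]≔ 0) + 1 * eval (∂ x′ f) w               ≡⟨ eval-[]≔-affine f x′ w 1 ⟨
        eval f (w [ x′ ]≔ 1)                                     ≡⟨ at-c u 1 ⟩
        eval (substAt i c f) ((removeAt u i) [ y ]≔ 0 [ x ]≔ 1)   ≡⟨ x-ignored (removeAt u i) ⟨
        eval (substAt i c f) ((removeAt u i) [ y ]≔ 0 [ x ]≔ 0)   ≡⟨ at-c u 0 ⟨
        eval f (w [ x′ ]≔ 0)                                     ≡⟨ +-identityʳ _ ⟨
        eval f (w [ x′ ]≔ 0) + 0                                 ∎) ⟩
      0                      ∎)
      where
      w = u [ y′ ]≔ 0 [ i ]≔ c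
  from : Nestˢ f x′ y′ → Nestˢ (substAt i c f) x y
  from (inj₁ x′≡y′)    = inj₁ (punchIn-injective i x y x′≡y′)
  from (inj₂ x-ignored) = inj₂ λ v → begin
    eval (substAt i c f) (v [ y ]≔ 0 [ x ]≔ 0)             ≡⟨ eval-substAt-[]≔ f i c v y x 0 0 ⟩
    eval f (insertAt v i c [ y′ ]≔ 0 [ x′ ]≔ 0)            ≡⟨ x-ignored (insertAt v i c) ⟩
    eval f (insertAt v i c [ y′ ]≔ 0 [ x′ ]≔ 1)            ≡⟨ eval-substAt-[]≔ f i c v y x 0 1 ⟨
    eval (substAt i c f) (v [ y ]≔ 0 [ x ]≔ 1)             ∎

-- Leading coefficients

-- coeff p m is the coefficient of the monomial ∏ { xⱼ ∣ m j ≡ true }.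
coeff : ∀ {n} → MPoly n → (Fin n → Bool) → ℕ
coeff {zero}  c         m = c
coeff {suc n} (p₀ , p₁) m = if m zero then coeff p₁ (tail m) else coeff p₀ (tail m)

coeff-cong : ∀ {n} (p : MPoly n) {A B : Fin n → Bool} → A ≗ B → coeff p A ≡ coeff p B
coeff-cong {zero}  p         A≗B = refl
coeff-cong {suc n} (p₀ , p₁) {A} {B} A≗B rewrite A≗B zero with B zero
... | true  = coeff-cong p₁ (A≗B ∘ suc)
... | false = coeff-cong p₀ (A≗B ∘ suc)

coeff-+p : ∀ {n} (p q : MPoly n) m → coeff (p +p q) m ≡ coeff p m + coeff q m
coeff-+p {zero}  p         q         m = refl
coeff-+p {suc n} (p₀ , p₁) (q₀ , q₁) m with m zero
... | true  = coeff-+p p₁ q₁ (tail m)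
... | false = coeff-+p p₀ q₀ (tail m)

coeff-pconst : ∀ {n} c → coeff (pconst {n} c) (const false) ≡ c
coeff-pconst {zero}  c = refl
coeff-pconst {suc n} c = coeff-pconst {n} c

coeff-pvar : ∀ {n} (x : Fin n) → coeff (pvar x) (λ j → does (j Fin.≟ x)) ≡ 1
coeff-pvar {suc n} zero    = coeff-pconst {n} 1
coeff-pvar {suc n} (suc x) = coeff-pvar x

coeff-*p : ∀ {n} (p q : MPoly n) (A B : Fin n → Bool) → (∀ j → A j ∧ B j ≡ false) →
           coeff p A * coeff q B ≤ coeff (p *p q) (λ j → A j ∨ B j)
coeff-*p {zero}  p         q         A B disj = ≤-refl
coeff-*p {suc n} (p₀ , p₁) (q₀ , q₁) A B disj with A zero | B zero | disj zero
... | true  | true  | ()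
... | true  | false | _ = begin
  coeff p₁ (tail A) * coeff q₀ (tail B)      ≤⟨ coeff-*p p₁ q₀ (tail A) (tail B) (disj ∘ suc) ⟩
  coeff (p₁ *p q₀) _                          ≤⟨ m≤n+m _ _ ⟩
  coeff (p₀ *p q₁) _ + coeff (p₁ *p q₀) _    ≡⟨ coeff-+p (p₀ *p q₁) (p₁ *p q₀) _ ⟨
  coeff ((p₀ *p q₁) +p (p₁ *p q₀)) _          ∎
  where open ≤-Reasoning
... | false | true  | _ = begin
  coeff p₀ (tail A) * coeff q₁ (tail B)      ≤⟨ coeff-*p p₀ q₁ (tail A) (tail B) (disj ∘ suc) ⟩
  coeff (p₀ *p q₁) _                          ≤⟨ m≤m+n _ _ ⟩
  coeff (p₀ *p q₁) _ + coeff (p₁ *p q₀) _    ≡⟨ coeff-+p (p₀ *p q₁) (p₁ *p q₀) _ ⟨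
  coeff ((p₀ *p q₁) +p (p₁ *p q₀)) _          ∎
  where open ≤-Reasoning
... | false | false | _ = coeff-*p p₀ q₀ (tail A) (tail B) (disj ∘ suc)

does-∧-disjoint : ∀ {P Q : Set} (P? : Dec P) (Q? : Dec Q) → (P → ¬ Q) → does P? ∧ does Q? ≡ false
does-∧-disjoint (no _)  Q? P⇒¬Q = refl
does-∧-disjoint (yes p) Q? P⇒¬Q = dec-false Q? (P⇒¬Q p)

vars : ∀ {n} → LDE n → Fin n → Bool
vars E j = does (occurs? j E)

coeff-poly-vars-pos : ∀ {n} (E : LDE n) → WF E → 1 ≤ coeff (poly E) (vars E)
coeff-poly-vars-pos {n} (cst c) 1≤c = subst (1 ≤_) (sym (coeff-pconst {n} c)) 1≤c
coeff-poly-vars-pos (E₁ ⊗ E₂) (wf₁ , wf₂ , disj) = begin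
  1                                                   ≤⟨ *-mono-≤ (coeff-poly-vars-pos E₁ wf₁) (coeff-poly-vars-pos E₂ wf₂) ⟩
  coeff (poly E₁) (vars E₁) * coeff (poly E₂) (vars E₂)
    ≤⟨ coeff-*p (poly E₁) (poly E₂) (vars E₁) (vars E₂) (λ j → does-∧-disjoint (occurs? j E₁) (occurs? j E₂) (disj j)) ⟩
  coeff (poly (E₁ ⊗ E₂)) (vars (E₁ ⊗ E₂))           ∎
  where open ≤-Reasoning
coeff-poly-vars-pos (lin E x c) (wf , x∉E , _) = begin
  1                                                   ≤⟨ coeff-poly-vars-pos E wf ⟩
  coeff (poly E) (vars E)                             ≡⟨ *-identityʳ _ ⟨
  coeff (poly E) (vars E) * 1                         ≡⟨ cong (coeff (poly E) (vars E) *_) (coeff-pvar x) ⟨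
  coeff (poly E) (vars E) * coeff (pvar x) mask
    ≤⟨ coeff-*p (poly E) (pvar x) (vars E) mask (λ j → does-∧-disjoint (occurs? j E) (j Fin.≟ x) λ { j∈E refl → x∉E j∈E }) ⟩
  coeff (poly E *p pvar x) (vars (lin E x c))         ≤⟨ m≤m+n _ _ ⟩
  coeff (poly E *p pvar x) (vars (lin E x c)) + coeff (pconst c) (vars (lin E x c))
    ≡⟨ coeff-+p (poly E *p pvar x) (pconst c) (vars (lin E x c)) ⟨
  coeff (poly (lin E x c)) (vars (lin E x c))         ∎
  where
  open ≤-Reasoning
  mask : Fin _ → Bool
  mask j = does (j Fin.≟ x)

lead≡coeff : ∀ {n} (p : MPoly n) → lead p ≡ coeff p (const true)
lead≡coeff {zero}  p         = refl
lead≡coeff {suc n} (p₀ , p₁) = lead≡coeff p₁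

lead-pos : ∀ {n} {E : LDE n} {p} → Represents E p → 1 ≤ lead p
lead-pos {E = E} (wf , all , refl) = begin
  1                              ≤⟨ coeff-poly-vars-pos E wf ⟩
  coeff (poly E) (vars E)        ≡⟨ coeff-cong (poly E) (λ j → dec-true (occurs? j E) (all j)) ⟩
  coeff (poly E) (const true)    ≡⟨ lead≡coeff (poly E) ⟨
  lead (poly E)                  ∎
  where open ≤-Reasoning

lead-+p : ∀ {n} (p q : MPoly n) → lead (p +p q) ≡ lead p + lead q
lead-+p {zero}  p         q         = refl
lead-+p {suc n} (p₀ , p₁) (q₀ , q₁) = lead-+p p₁ q₁

lead-·p : ∀ {n} (c : ℕ) (p : MPoly n) → lead (c ·p p) ≡ c * lead p
lead-·p {zero}  c p         = refl
lead-·p {suc n} c (p₀ , p₁) = lead-·p c p₁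

lead-substAt : ∀ {n} (i : Fin (suc n)) (t : ℕ) (p : MPoly (suc n)) →
               lead (substAt i t p) ≡ lead (substAt i 0 p) + t * lead p
lead-substAt zero t (p₀ , p₁) = begin
  lead (p₀ +p (t ·p p₁))                 ≡⟨ lead-+p p₀ (t ·p p₁) ⟩
  lead p₀ + lead (t ·p p₁)               ≡⟨ cong (lead p₀ +_) (lead-·p t p₁) ⟩
  lead p₀ + t * lead p₁                  ≡⟨ cong (_+ t * lead p₁) (+-identityʳ (lead p₀)) ⟨
  lead p₀ + 0 + t * lead p₁              ≡⟨ cong (λ s → lead p₀ + s + t * lead p₁) (lead-·p 0 p₁) ⟨
  lead p₀ + lead (0 ·p p₁) + t * lead p₁ ≡⟨ cong (_+ t * lead p₁) (lead-+p p₀ (0 ·p p₁)) ⟨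
  lead (p₀ +p (0 ·p p₁)) + t * lead p₁   ∎
  where open ≡-Reasoning
lead-substAt {suc n} (suc i) t (p₀ , p₁) = lead-substAt i t p₁

-- Substituting a constant for a minimal variable

Closed : ∀ {n} → LDE n → Set
Closed E = ∀ j → ¬ Occ j E

ClosedBinder : ∀ {n} → Fin n → LDE n → Set
ClosedBinder i E = ∀ {S c} → lin S i c ⊑ E → Closed S

⟦⟧-closed : ∀ {n} (E : LDE n) → Closed E → ∀ u w → ⟦ E ⟧ u ≡ ⟦ E ⟧ w
⟦⟧-closed (cst c)     closed u w = refl
⟦⟧-closed (E₁ ⊗ E₂)   closed u w =
  cong₂ _*_ (⟦⟧-closed E₁ (λ j → closed j ∘ inj₁) u w) (⟦⟧-closed E₂ (λ j → closed j ∘ inj₂) u w)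
⟦⟧-closed (lin E x c) closed u w = ⊥-elim (closed x (inj₂ refl))

-- Under ClosedBinder i the body E of the binder of i is closed, so any valuation gives its value.
substE : ∀ {r} → Fin (suc r) → ℕ → LDE (suc r) → LDE r
substE i t (cst c)     = cst c
substE i t (E₁ ⊗ E₂)   = substE i t E₁ ⊗ substE i t E₂
substE i t (lin E x c) with i Fin.≟ x
... | yes _   = cst (⟦ E ⟧ (const 1) * t + c)
... | no  i≢x = lin (substE i t E) (punchOut i≢x) c

NestMinimal⇒ClosedBinder : ∀ {r} {f : MPoly r} {E} → Represents E f → ∀ {i} → NestMinimal f i → ClosedBinder i E
NestMinimal⇒ClosedBinder {E = E} rep@(wf , _ , _) {i} minimal {S} binder⊑E j j∈S
  with minimal j (E , rep , _ , binder⊑E , inj₂ refl , (λ S′ S′⊑E i∈S′ → binder-least wf binder⊑E S′⊑E i∈S′) , inj₁ j∈S)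
... | refl = proj₁ (proj₂ (WF-⊑ binder⊑E wf)) j∈S

⟦substE⟧ : ∀ {r} (i : Fin (suc r)) (t : ℕ) (E : LDE (suc r)) → ClosedBinder i E →
           ∀ v → ⟦ substE i t E ⟧ v ≡ ⟦ E ⟧ (insertAt v i t)
⟦substE⟧ i t (cst c)     closed v = refl
⟦substE⟧ i t (E₁ ⊗ E₂)   closed v =
  cong₂ _*_ (⟦substE⟧ i t E₁ (closed ∘ ⊑-⊗ˡ) v) (⟦substE⟧ i t E₂ (closed ∘ ⊑-⊗ʳ) v)
⟦substE⟧ i t (lin E x c) closed v with i Fin.≟ x
... | yes refl = cong (_+ c) (cong₂ _*_ (⟦⟧-closed E (closed ⊑-refl) _ _) (sym (insertAt-lookup v i t)))
... | no  i≢x  = cong (_+ c) (cong₂ _*_ (⟦substE⟧ i t E (closed ∘ ⊑-lin) v) (sym (begin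
  insertAt v i t x                           ≡⟨ cong (insertAt v i t) (punchIn-punchOut i≢x) ⟨
  insertAt v i t (punchIn i (punchOut i≢x))  ≡⟨ insertAt-punchIn v i t (punchOut i≢x) ⟩
  v (punchOut i≢x)                           ∎)))
  where open ≡-Reasoning

Occ-substE : ∀ {r} (i : Fin (suc r)) (t : ℕ) (E : LDE (suc r)) {j} → Occ j (substE i t E) → Occ (punchIn i j) E
Occ-substE i t (E₁ ⊗ E₂)   (inj₁ j∈E₁) = inj₁ (Occ-substE i t E₁ j∈E₁)
Occ-substE i t (E₁ ⊗ E₂)   (inj₂ j∈E₂) = inj₂ (Occ-substE i t E₂ j∈E₂)
Occ-substE i t (lin E x c) j∈E′ with i Fin.≟ x
Occ-substE i t (lin E x c) ()          | yes _
Occ-substE i t (lin E x c) (inj₁ j∈E)  | no i≢x = inj₁ (Occ-substE i t E j∈E)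
Occ-substE i t (lin E x c) (inj₂ refl) | no i≢x = inj₂ (punchIn-punchOut i≢x)

Occ-substE⁻ : ∀ {r} (i : Fin (suc r)) (t : ℕ) (E : LDE (suc r)) → ClosedBinder i E →
              ∀ {j} → Occ (punchIn i j) E → Occ j (substE i t E)
Occ-substE⁻ i t (E₁ ⊗ E₂)   closed (inj₁ j∈E₁) = inj₁ (Occ-substE⁻ i t E₁ (closed ∘ ⊑-⊗ˡ) j∈E₁)
Occ-substE⁻ i t (E₁ ⊗ E₂)   closed (inj₂ j∈E₂) = inj₂ (Occ-substE⁻ i t E₂ (closed ∘ ⊑-⊗ʳ) j∈E₂)
Occ-substE⁻ i t (lin E x c) closed {j} j∈E′ with i Fin.≟ x
Occ-substE⁻ i t (lin E x c) closed {j} (inj₁ j∈E) | yes refl = ⊥-elim (closed ⊑-refl _ j∈E)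
Occ-substE⁻ i t (lin E x c) closed {j} (inj₂ j≡i) | yes refl = ⊥-elim (punchInᵢ≢i i j j≡i)
Occ-substE⁻ i t (lin E x c) closed {j} (inj₁ j∈E) | no i≢x = inj₁ (Occ-substE⁻ i t E (closed ∘ ⊑-lin) j∈E)
Occ-substE⁻ i t (lin E x c) closed {j} (inj₂ j≡x) | no i≢x =
  inj₂ (punchIn-injective i j (punchOut i≢x) (trans j≡x (sym (punchIn-punchOut i≢x))))

WF-substE : ∀ {r} (i : Fin (suc r)) (t : ℕ) (E : LDE (suc r)) → WF E → WF (substE i t E)
WF-substE i t (cst c)     1≤c = 1≤c
WF-substE i t (E₁ ⊗ E₂)   (wf₁ , wf₂ , disj) =
  WF-substE i t E₁ wf₁ , WF-substE i t E₂ wf₂ , λ j j∈E₁ j∈E₂ → disj _ (Occ-substE i t E₁ j∈E₁) (Occ-substE i t E₂ j∈E₂)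
WF-substE i t (lin E x c) (wf , x∉E , 1≤c) with i Fin.≟ x
... | yes _   = ≤-trans 1≤c (m≤n+m c _)
... | no  i≢x = WF-substE i t E wf , (λ x′∈E′ → x∉E (subst (λ z → Occ z E) (punchIn-punchOut i≢x) (Occ-substE i t E x′∈E′))) , 1≤c

represents-substE : ∀ {r} {E : LDE (suc r)} {f} → Represents E f → ∀ {i} → ClosedBinder i E →
                    ∀ t → Represents (substE i t E) (substAt i t f)
represents-substE {E = E} {f} rep@(wf , all , _) {i} closed t =
  WF-substE i t E wf , (λ j → Occ-substE⁻ i t E closed (all (punchIn i j))) , eval-injective _ _ λ v → begin
    eval (poly (substE i t E)) v   ≡⟨ eval-poly (substE i t E) (WF-substE i t E wf) v ⟩
    ⟦ substE i t E ⟧ v             ≡⟨ ⟦substE⟧ i t E closed v ⟩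
    ⟦ E ⟧ (insertAt v i t)         ≡⟨ eval-represents rep _ ⟨
    eval f (insertAt v i t)        ≡⟨ eval-substAt i t f v ⟨
    eval (substAt i t f) v         ∎
  where open ≡-Reasoning

lead-substAt-> : ∀ {r} {f : MPoly (suc r)} {E} → Represents E f → ∀ {i} → ClosedBinder i E →
                 ∀ t → lead f * t < lead (substAt i t f)
lead-substAt-> {f = f} rep {i} closed t = begin-strict
  lead f * t                           ≡⟨ *-comm (lead f) t ⟩
  t * lead f                           <⟨ m<n+m (t * lead f) (lead-pos (represents-substE rep closed 0)) ⟩
  lead (substAt i 0 f) + t * lead f    ≡⟨ lead-substAt i t f ⟨
  lead (substAt i t f)                 ∎
  where open ≤-Reasoning

-- Integer complexity

Expressible : ℕ → ℕ → Set
Expressible N b = Σ AExpr λ e → aval e ≡ N × ones e ≤ b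

exprs≤ : ℕ → List AExpr
exprs≤ zero    = []
exprs≤ (suc m) = [ one ] ++ cartesianProductWith plus (exprs≤ m) (exprs≤ m)
                         ++ cartesianProductWith times (exprs≤ m) (exprs≤ m)

ones-pos : ∀ e → 1 ≤ ones e
ones-pos one         = ≤-refl
ones-pos (plus a b)  = ≤-trans (ones-pos a) (m≤m+n _ _)
ones-pos (times a b) = ≤-trans (ones-pos a) (m≤m+n _ _)

ones-split : ∀ a b {m} → ones a + ones b ≤ suc m → ones a ≤ m × ones b ≤ m
ones-split a b sum≤ =
  ≤-pred (≤-trans (≤-reflexive (+-comm 1 (ones a))) (≤-trans (+-monoʳ-≤ (ones a) (ones-pos b)) sum≤)) ,
  ≤-pred (≤-trans (+-monoˡ-≤ (ones b) (ones-pos a)) sum≤)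

∈-exprs≤ : ∀ e {m} → ones e ≤ m → e ∈ exprs≤ m
∈-exprs≤ e {zero} ones≤0 = ⊥-elim (<-irrefl refl (≤-trans (ones-pos e) ones≤0))
∈-exprs≤ one         {suc m} _ = here refl
∈-exprs≤ (plus a b)  {suc m} ones≤ with ones-split a b ones≤
... | a≤ , b≤ = there (∈-++⁺ˡ (∈-cartesianProductWith⁺ plus (∈-exprs≤ a a≤) (∈-exprs≤ b b≤)))
∈-exprs≤ (times a b) {suc m} ones≤ with ones-split a b ones≤
... | a≤ , b≤ = there (∈-++⁺ʳ _ (∈-cartesianProductWith⁺ times (∈-exprs≤ a a≤) (∈-exprs≤ b b≤)))

expressible? : ∀ N b → Dec (Expressible N b)
expressible? N b with any? (λ e → (aval e ≟ N) ×-dec (ones e ≤? b)) (exprs≤ b)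
... | yes found = yes (satisfied found)
... | no  none  = no λ { (e , e↦N , ones≤b) → none (lose (∈-exprs≤ e ones≤b) (e↦N , ones≤b)) }

least-witness : {P : ℕ → Set} → (∀ m → Dec (P m)) → (∀ {m n} → m ≤ n → P m → P n) →
                ∀ b → P b → Σ ℕ λ m → m ≤ b × P m × (∀ {m′} → m′ < m → ¬ P m′)
least-witness P? mono zero    Pb = 0 , ≤-refl , Pb , λ ()
least-witness P? mono (suc b) Pb with P? b
... | no ¬Pb = suc b , ≤-refl , Pb , λ m′<1+b Pm′ → ¬Pb (mono (≤-pred m′<1+b) Pm′)
... | yes Pb′ with least-witness P? mono b Pb′
...   | m , m≤b , Pm , below = m , m≤n⇒m≤1+n m≤b , Pm , below

complexity-≤ : ∀ {N b} → Expressible N b → Σ ℕ λ m → IsCpx N m × m ≤ b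
complexity-≤ {N} {b} expressible
  with least-witness (expressible? N) (λ { m≤n (e , e↦N , ones≤m) → e , e↦N , ≤-trans ones≤m m≤n }) b expressible
... | m , m≤b , (e , e↦N , ones≤m) , below = m , ((e , e↦N , ≤-antisym ones≤m (minimal e e↦N)) , minimal) , m≤b
  where
  minimal : ∀ e′ → aval e′ ≡ N → m ≤ ones e′
  minimal e′ e′↦N = ≮⇒≥ λ ones<m → below ones<m (e′ , e′↦N , ≤-refl)

expressible-* : ∀ {a b ma mb} → Expressible a ma → Expressible b mb → Expressible (a * b) (ma + mb)
expressible-* (e , refl , ≤ma) (e′ , refl , ≤mb) = times e e′ , refl , +-mono-≤ ≤ma ≤mb

expressible-+ : ∀ {a b ma mb} → Expressible a ma → Expressible b mb → Expressible (a + b) (ma + mb)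
expressible-+ (e , refl , ≤ma) (e′ , refl , ≤mb) = plus e e′ , refl , +-mono-≤ ≤ma ≤mb

expressible-*3^ : ∀ {s m} k → Expressible s m → Expressible (s * 3 ^ k) (m + 3 * k)
expressible-*3^ {s} {m} zero (e , refl , ≤m) = e , sym (*-identityʳ s) , ≤-trans ≤m (m≤m+n m 0)
expressible-*3^ {s} {m} (suc k) expressible
  with expressible-* (expressible-*3^ k expressible) (plus one (plus one one) , refl , ≤-refl)
... | e , e↦ , ones≤ = e , trans e↦ (value s (3 ^ k)) , ≤-trans ones≤ (≤-reflexive (bound m k))
  where
  value : ∀ s t → s * t * 3 ≡ s * (3 * t)
  value = solve-∀
  bound : ∀ m k → m + 3 * k + 3 ≡ m + 3 * suc k
  bound = solve-∀

expressible-closed : ∀ {n} (S : LDE n) → Closed S → ∀ {m} → Cpx S m → ∀ v → Expressible (⟦ S ⟧ v) m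
expressible-closed (cst c)     closed ((e , e↦c , ones≡m) , _) v = e , e↦c , ≤-reflexive ones≡m
expressible-closed (E₁ ⊗ E₂)   closed (m₁ , m₂ , cpx₁ , cpx₂ , refl) v =
  expressible-* (expressible-closed E₁ (λ j → closed j ∘ inj₁) cpx₁ v) (expressible-closed E₂ (λ j → closed j ∘ inj₂) cpx₂ v)
expressible-closed (lin E x c) closed cpx v = ⊥-elim (closed x (inj₂ refl))

Cpx-substE-absent : ∀ {r} (i : Fin (suc r)) (t : ℕ) (E : LDE (suc r)) → ¬ Occ i E → ∀ {m} → Cpx E m → Cpx (substE i t E) m
Cpx-substE-absent i t (cst c)     i∉E cpx = cpx
Cpx-substE-absent i t (E₁ ⊗ E₂)   i∉E (m₁ , m₂ , cpx₁ , cpx₂ , m≡) =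
  m₁ , m₂ , Cpx-substE-absent i t E₁ (i∉E ∘ inj₁) cpx₁ , Cpx-substE-absent i t E₂ (i∉E ∘ inj₂) cpx₂ , m≡
Cpx-substE-absent i t (lin E x c) i∉E cpx with i Fin.≟ x
... | yes i≡x = ⊥-elim (i∉E (inj₂ i≡x))
Cpx-substE-absent i t (lin E x c) i∉E (m₁ , m₂ , cpx₁ , cpx₂ , m≡) | no i≢x =
  m₁ , m₂ , Cpx-substE-absent i t E (i∉E ∘ inj₁) cpx₁ , cpx₂ , m≡

-- The binder lin S i c becomes the constant ⟦ S ⟧ · 3^k + c, which costs at most ‖S‖ + 3k + ‖c‖.
Cpx-substE-3^ : ∀ {r} (i : Fin (suc r)) (k : ℕ) (E : LDE (suc r)) → WF E → ClosedBinder i E → Occ i E →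
                ∀ {m} → Cpx E m → Σ ℕ λ m′ → Cpx (substE i (3 ^ k) E) m′ × m′ ≤ m + 3 * k
Cpx-substE-3^ i k (E₁ ⊗ E₂) (wf₁ , _ , disj) closed (inj₁ i∈E₁) (m₁ , m₂ , cpx₁ , cpx₂ , refl)
  with Cpx-substE-3^ i k E₁ wf₁ (closed ∘ ⊑-⊗ˡ) i∈E₁ cpx₁
... | m₁′ , cpx₁′ , m₁′≤ =
  m₁′ + m₂ , (m₁′ , m₂ , cpx₁′ , Cpx-substE-absent i _ E₂ (disj i i∈E₁) cpx₂ , refl) ,
  ≤-trans (+-monoˡ-≤ m₂ m₁′≤) (≤-reflexive (xy∙z≈xz∙y m₁ (3 * k) m₂))
Cpx-substE-3^ i k (E₁ ⊗ E₂) (_ , wf₂ , disj) closed (inj₂ i∈E₂) (m₁ , m₂ , cpx₁ , cpx₂ , refl)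
  with Cpx-substE-3^ i k E₂ wf₂ (closed ∘ ⊑-⊗ʳ) i∈E₂ cpx₂
... | m₂′ , cpx₂′ , m₂′≤ =
  m₁ + m₂′ , (m₁ , m₂′ , Cpx-substE-absent i _ E₁ (λ i∈E₁ → disj i i∈E₁ i∈E₂) cpx₁ , cpx₂′ , refl) ,
  ≤-trans (+-monoʳ-≤ m₁ m₂′≤) (≤-reflexive (sym (+-assoc m₁ m₂ (3 * k))))
Cpx-substE-3^ i k (lin E x c) wf closed i∈E′ cpx with i Fin.≟ x
Cpx-substE-3^ i k (lin E x c) wf closed i∈E′ (m₁ , m₂ , cpx₁ , ((e , e↦c , ones≡m₂) , _) , refl) | yes refl
  with complexity-≤ (expressible-+ (expressible-*3^ k (expressible-closed E (closed ⊑-refl) cpx₁ (const 1)))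
                                   (e , e↦c , ≤-reflexive ones≡m₂))
... | m′ , cpx′ , m′≤ = m′ , cpx′ , ≤-trans m′≤ (≤-reflexive (xy∙z≈xz∙y m₁ (3 * k) m₂))
Cpx-substE-3^ i k (lin E x c) wf closed (inj₂ i≡x) cpx | no i≢x = ⊥-elim (i≢x i≡x)
Cpx-substE-3^ i k (lin E x c) (wf , _ , _) closed (inj₁ i∈E) (m₁ , m₂ , cpx₁ , cpx₂ , refl) | no i≢x
  with Cpx-substE-3^ i k E wf (closed ∘ ⊑-lin) i∈E cpx₁
... | m₁′ , cpx₁′ , m₁′≤ =
  m₁′ + m₂ , (m₁′ , m₂ , cpx₁′ , cpx₂ , refl) , ≤-trans (+-monoˡ-≤ m₂ m₁′≤) (≤-reflexive (xy∙z≈xz∙y m₁ (3 * k) m₂))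

-- Defects

<δ-lead : ∀ C k {a b} → a * 3 ^ k < b → defect (C + 3 * k) b <δ defect C a
<δ-lead C k {a} {b} a3ᵏ<b = begin-strict
  3 ^ (C + 3 * k) * a ^ 3       ≡⟨ cong (_* a ^ 3) (^-distribˡ-+-* 3 C (3 * k)) ⟩
  3 ^ C * 3 ^ (3 * k) * a ^ 3   ≡⟨ cong (λ e → 3 ^ C * 3 ^ e * a ^ 3) (*-comm 3 k) ⟩
  3 ^ C * 3 ^ (k * 3) * a ^ 3   ≡⟨ cong (λ t → 3 ^ C * t * a ^ 3) (^-*-assoc 3 k 3) ⟨
  3 ^ C * (3 ^ k) ^ 3 * a ^ 3   ≡⟨ regroup (3 ^ C) (3 ^ k) a ⟩
  3 ^ C * (a * 3 ^ k) ^ 3       <⟨ *-monoʳ-<-pos (3 ^ C) (m^n>0 3 C) (^-monoˡ-< 3 a3ᵏ<b) ⟩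
  3 ^ C * b ^ 3                 ∎
  where
  open ≤-Reasoning
  -- Cubes are written out because the ring solver does not normalise _^_.
  regroup : ∀ c t a → c * (t * (t * (t * 1))) * (a * (a * (a * 1))) ≡ c * ((a * t) * ((a * t) * ((a * t) * 1)))
  regroup = solve-∀

sumF-insertAt : ∀ {r} (ks : Vector ℕ r) (i : Fin (suc r)) (k : ℕ) → sumF (insertAt ks i k) ≡ k + sumF ks
sumF-insertAt         ks zero    k = refl
sumF-insertAt {suc r} ks (suc i) k = begin
  ks zero + sumF (insertAt (tail ks) i k)   ≡⟨ cong (ks zero +_) (sumF-insertAt (tail ks) i k) ⟩
  ks zero + (k + sumF (tail ks))            ≡⟨ +-assoc (ks zero) k _ ⟨
  ks zero + k + sumF (tail ks)              ≡⟨ cong (_+ sumF (tail ks)) (+-comm (ks zero) k) ⟩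
  k + ks zero + sumF (tail ks)              ≡⟨ +-assoc k (ks zero) _ ⟩
  k + (ks zero + sumF (tail ks))            ∎
  where open ≡-Reasoning

δat-substAt : ∀ {r} (f : MPoly (suc r)) (i : Fin (suc r)) (C k : ℕ) (ks : Vector ℕ r) →
              δat (substAt i (3 ^ k) f) (C + 3 * k) ks ≈δ δat f C (insertAt ks i k)
δat-substAt f i C k ks = cong₂ (λ e a → 3 ^ e * a ^ 3) exponents values
  where
  open ≡-Reasoning
  exponents : C + 3 * k + 3 * sumF ks ≡ C + 3 * sumF (insertAt ks i k)
  exponents = begin
    C + 3 * k + 3 * sumF ks      ≡⟨ +-assoc C (3 * k) _ ⟩
    C + (3 * k + 3 * sumF ks)    ≡⟨ cong (C +_) (*-distribˡ-+ 3 k (sumF ks)) ⟨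
    C + 3 * (k + sumF ks)        ≡⟨ cong (λ s → C + 3 * s) (sumF-insertAt ks i k) ⟨
    C + 3 * sumF (insertAt ks i k) ∎
  values : eval f (λ j → 3 ^ insertAt ks i k j) ≡ eval (substAt i (3 ^ k) f) (λ j → 3 ^ ks j)
  values = begin
    eval f (λ j → 3 ^ insertAt ks i k j)           ≡⟨ eval-cong f (insertAt-map (3 ^_) ks i k) ⟩
    eval f (insertAt (λ j → 3 ^ ks j) i (3 ^ k))    ≡⟨ eval-substAt i (3 ^ k) f _ ⟨
    eval (substAt i (3 ^ k) f) (λ j → 3 ^ ks j)    ∎

proposition4p1 : ∀ {r : ℕ} (f : MPoly (suc r)) (C : ℕ) → LDPair f C
  → (i : Fin (suc r)) → NestMinimal f i → (k : ℕ)
  → (IsLDPoly (substAt i (3 ^ k) f) × LDPair (substAt i (3 ^ k) f) (C + 3 * k))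
    × (lead f * 3 ^ k < lead (substAt i (3 ^ k) f)
       × δ (substAt i (3 ^ k) f) (C + 3 * k) <δ δ f C)
    × (∀ (x y : Fin r) → Nest (substAt i (3 ^ k) f) x y ⇔ Nest f (punchIn i x) (punchIn i y))
    × (∀ (ks : Fin r → ℕ) → δat (substAt i (3 ^ k) f) (C + 3 * k) ks ≈δ δat f C (insertAt ks i k))
proposition4p1 f C (E , rep@(wf , all , _) , m , cpx , m≤C) i minimal k =
  ((E′ , rep′) , (E′ , rep′ , low-defect-pair)) ,
  (lead< , <δ-lead C k {lead f} lead<) ,
  (λ x y → ⇔-sym (Nest⇔Nestˢ rep) ⇔-∘ (Nestˢ-substAt f i (m^n>0 3 k) x y ⇔-∘ Nest⇔Nestˢ rep′)) ,
  δat-substAt f i C k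
  where
  closed : ClosedBinder i E
  closed = NestMinimal⇒ClosedBinder rep minimal
  E′ : LDE _
  E′ = substE i (3 ^ k) E
  rep′ : Represents E′ (substAt i (3 ^ k) f)
  rep′ = represents-substE rep closed (3 ^ k)
  low-defect-pair : Σ ℕ λ m′ → Cpx E′ m′ × m′ ≤ C + 3 * k
  low-defect-pair with Cpx-substE-3^ i k E wf closed (all i) cpx
  ... | m′ , cpx′ , m′≤ = m′ , cpx′ , ≤-trans m′≤ (+-monoˡ-≤ (3 * k) m≤C)
  lead< : lead f * 3 ^ k < lead (substAt i (3 ^ k) f)
  lead< = lead-substAt-> rep closed (3 ^ k)
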